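{- Let $n\ge 1$ and let $\mathbf{H}$ be an $n\times n$ Hadamard matrix. For $1\le i\le n$ let $\delta_i,\gamma_i$ be integers and $\Delta_i,\Gamma_i$ be positive integers, and define $$DQ_i(x)=\operatorname{sign}(x)\left\lfloor \frac{\max(0,|x|+\delta_i)}{\Delta_i}\right\rfloor,\qquad IQ_i(x)=\operatorname{sign}(x)\,(\Gamma_i|x|+\gamma_i),$$ and for a vector $\mathbf{v}=(v_1,\dots,v_n)$ set $\mathbf{DQ}(\mathbf{v})=(DQ_1(v_1),\dots,DQ_n(v_n))$ and $\mathbf{IQ}(\mathbf{v})=(IQ_1(v_1),\dots,IQ_n(v_n))$. For $\mathbf{x}\in\mathbb{Z}^n$ let $$\mathbf{x}'=\mathbf{H}^T\,\mathbf{IQ}\!\left(\mathbf{DQ}\!\left(\tfrac1n\mathbf{H}\mathbf{x}\right)\right).$$ Then for every $\mathbf{x}\in\mathbb{Z}^n$, $$\|\mathbf{x}'-\mathbf{x}\|_\infty\le n\max_{1\le i\le n}\max S_i,$$ where, writing $X=\|\mathbf{x}\|_\infty$, the finite set $S_i$ of nonnegative reals consists of: - $|\Delta_i-\delta_i|$ (always); - if $X\ge \Delta_i-\delta_i$: the numbers $|(\Gamma_i-\Delta_i)+\gamma_i+\delta_i|$ and $\left|\left\lfloor \frac{X+\delta_i}{\Delta_i}\right\rfloor(\Gamma_i-\Delta_i)+\gamma_i+\delta_i\right|$; - if $X>\Delta_i-\delta_i$: the numbers $|2(\Gamma_i-\Delta_i)+\gamma_i+\delta_i-\Gamma_i|$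 and $\left|\left\lceil \frac{X+\delta_i}{\Delta_i}\right\rceil(\Gamma_i-\Delta_i)+\gamma_i+\delta_i-\Gamma_i\right|$. Moreover, if $\Delta_i=\Gamma_i$ for all $i$, then for every $\mathbf{x}\in\mathbb{Z}^n$, $$\|\mathbf{x}'-\mathbf{x}\|_\infty\le n\max_{1\le i\le n}\max\bigl(|\gamma_i+\delta_i|,\ |\gamma_i+\delta_i-\Delta_i|,\ |\Delta_i-\delta_i|\bigr).$$
   Context: A Hadamard matrix of order $n$ is an $n\times n$ matrix with entries in $\{+1,-1\}$ whose rows are mutually orthogonal (so $\mathbf{H}^T\mathbf{H}=n\mathbf{I}_n$). $\operatorname{sign}(x)$ is $1$, $0$, $-1$ for $x>0$, $x=0$, $x<0$ respectively. $\|\mathbf{v}\|_\infty=\max_i|v_i|$. -}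

module Defs where

open import Data.Nat as ℕ using (ℕ; zero; suc; _⊔_)
open import Data.Integer as ℤ using (ℤ; +_; +0; +[1+_]; -[1+_]; ∣_∣)
open import Data.Rational as ℚ using (ℚ; floor; ceiling; ↥_)
open import Data.Fin using (Fin; zero; suc)
open import Data.Bool using (if_then_else_)
open import Relation.Nullary using (does)
open import Relation.Binary.PropositionalEquality using (_≡_)

Σℤ : ∀ {n} → (Fin n → ℤ) → ℤ
Σℤ {zero} f = + 0
Σℤ {suc n} f = f zero ℤ.+ Σℤ (λ i → f (suc i))

maxFin : ∀ {n} → (Fin n → ℕ) → ℕ
maxFin {zero} f = 0
maxFin {suc n} f = f zero ⊔ maxFin (λ i → f (suc i))

IsHadamard : (n : ℕ) → (Fin n → Fin n → ℤ) → Set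
IsHadamard n H =
  (∀ i j → (H i j ≡ + 1) Data.Sum.⊎ (H i j ≡ ℤ.- + 1))
  Data.Product.× (∀ i j → Σℤ (λ k → H k i ℤ.* H k j) ≡ (if does (i Data.Fin.≟ j) then + n else + 0))
  where import Data.Sum; import Data.Product; import Data.Fin

sgnℤ : ℤ → ℤ
sgnℤ +0 = + 0
sgnℤ +[1+ _ ] = + 1
sgnℤ -[1+ _ ] = ℤ.- + 1

-- sign of a rational (denominator is positive)
sgnℚ : ℚ → ℤ
sgnℚ q = sgnℤ (↥ q)

absℤ : ℤ → ℤ
absℤ m = + ∣ m ∣

-- DQ(x) = sign(x) ⌊ max(0, |x| + δ) / Δ ⌋ ; Δ = 0 gives junk 0 (excluded by hypothesis)
DQ : ℤ → ℕ → ℚ → ℤ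
DQ δ zero q = + 0
DQ δ Δ@(suc _) q =
  sgnℚ q ℤ.* floor ((ℚ.0ℚ ℚ.⊔ (ℚ.∣ q ∣ ℚ.+ (δ ℚ./ 1))) ℚ.* (+ 1 ℚ./ Δ))

IQ : ℤ → ℕ → ℤ → ℤ
IQ γ Γ m = sgnℤ m ℤ.* ((+ Γ) ℤ.* absℤ m ℤ.+ γ)

scaledH : (n : ℕ) → (Fin n → Fin n → ℤ) → (Fin n → ℤ) → Fin n → ℚ
scaledH zero H x ()
scaledH n@(suc _) H x i = Σℤ (λ k → H i k ℤ.* x k) ℚ./ n

reconstruct : (n : ℕ) → (Fin n → Fin n → ℤ) →
  (δ γ : Fin n → ℤ) → (Δ Γ : Fin n → ℕ) → (Fin n → ℤ) → Fin n → ℤ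
reconstruct n H δ γ Δ Γ x j =
  Σℤ (λ i → H i j ℤ.* IQ (γ i) (Γ i) (DQ (δ i) (Δ i) (scaledH n H x i)))

supNorm : ∀ {n} → (Fin n → ℤ) → ℕ
supNorm x = maxFin (λ j → ∣ x j ∣)

-- (X + δ)/Δ as a rational (Δ = 0 junk)
ratio : ℕ → ℤ → ℕ → ℚ
ratio X δ zero = ℚ.0ℚ
ratio X δ Δ@(suc _) = (+ X ℤ.+ δ) ℚ./ Δ

maxS : ℤ → ℤ → ℕ → ℕ → ℕ → ℕ
maxS δ γ Δ Γ X =
  ∣ + Δ ℤ.- δ ∣
  ⊔ (if does ((+ Δ ℤ.- δ) ℤ.≤? + X)
      then ∣ (+ Γ ℤ.- + Δ) ℤ.+ γ ℤ.+ δ ∣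
           ⊔ ∣ floor (ratio X δ Δ) ℤ.* (+ Γ ℤ.- + Δ) ℤ.+ γ ℤ.+ δ ∣
      else 0)
  ⊔ (if does ((+ Δ ℤ.- δ) ℤ.<? + X)
      then ∣ + 2 ℤ.* (+ Γ ℤ.- + Δ) ℤ.+ γ ℤ.+ δ ℤ.- + Γ ∣
           ⊔ ∣ ceiling (ratio X δ Δ) ℤ.* (+ Γ ℤ.- + Δ) ℤ.+ γ ℤ.+ δ ℤ.- + Γ ∣
      else 0)

maxT : ℤ → ℤ → ℕ → ℕ
maxT δ γ Δ = ∣ γ ℤ.+ δ ∣ ⊔ ∣ γ ℤ.+ δ ℤ.- + Δ ∣ ⊔ ∣ + Δ ℤ.- δ ∣

{-# OPTIONS --safe #-}
-- With s = H x, orthogonality Hᵀ H = n I gives n (x′ − x) = Hᵀ (n z − s) for z = IQ (DQ (s / n)),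
-- and since H has entries ±1 it suffices to bound each |n zᵢ − sᵢ| by n · max Sᵢ.  In a coordinate
-- write N = n and t = |sᵢ|; then DQ (sᵢ / N) = sign(sᵢ) k with k = ⌊max(0, t + Nδ) / (NΔ)⌋.  For
-- k = 0 the error is t < N (Δ − δ).  For k ≥ 1 it is ±(N (Γ k + γ) − t), which lies in the window
-- (N L(k+1), N U(k)] of the affine maps U(k) = k (Γ − Δ) + γ + δ and L(k) = U(k) − Γ.  As t ≤ N X,
-- the level satisfies 1 ≤ k ≤ ⌊(X + δ)/Δ⌋, and 2 ≤ k + 1 ≤ ⌈(X + δ)/Δ⌉ unless t + Nδ = k N Δ, when
-- the error is exactly N U(k).  An affine map is extremal at the ends of an interval, and the end
-- values are the elements of Sᵢ.  For Δ = Γ, U and L are the constants γ + δ and γ + δ − Δ.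
module Submission where

open import Defs
open import Data.Nat as ℕ using (ℕ; zero; suc)
import Data.Nat.Properties as ℕ
open import Data.Integer as ℤ using (ℤ; +_; +0; +[1+_]; -[1+_]; ∣_∣; _-_)
import Data.Integer.Properties as ℤ
import Data.Rational as ℚ
open import Data.Fin using (Fin; zero; suc; _≟_)
open import Data.Bool using (if_then_else_)
open import Data.Product using (_×_; _,_; proj₁; proj₂; ∃-syntax)
open import Data.Sum using (_⊎_; inj₁; inj₂)
open import Relation.Nullary using (does)
open import Relation.Binary.PropositionalEquality
open import Data.Integer.Tactic.RingSolver using (solve-∀)

module FiniteSums where
  open import Data.Integer using (_+_; _*_)
  open import Algebra.Properties.Semiring.Sum ℤ.+-*-semiring using (sum; sum-replicate-zero)

  Σℤ≡sum : ∀ {n} (f : Fin n → ℤ) → Σℤ f ≡ sum f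
  Σℤ≡sum {zero}  f = refl
  Σℤ≡sum {suc n} f = cong (_+_ (f zero)) (Σℤ≡sum (λ i → f (suc i)))

  sum-indicator : ∀ {n} (j : Fin n) c (x : Fin n → ℤ) →
    sum (λ k → (if does (j ≟ k) then c else + 0) * x k) ≡ c * x j
  sum-indicator {suc n} zero    c x =
    trans (cong (_+_ (c * x zero)) (sum-replicate-zero n)) (ℤ.+-identityʳ _)
  sum-indicator {suc n} (suc j) c x =
    trans (ℤ.+-identityˡ _) (sum-indicator j c (λ k → x (suc k)))

  ∣Σℤ∣≤ : ∀ {n} (f : Fin n → ℤ) {b} → (∀ i → ∣ f i ∣ ℕ.≤ b) → ∣ Σℤ f ∣ ℕ.≤ n ℕ.* b
  ∣Σℤ∣≤ {zero}  f bound = ℕ.z≤n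
  ∣Σℤ∣≤ {suc n} f bound = ℕ.≤-trans (ℤ.∣i+j∣≤∣i∣+∣j∣ (f zero) _)
    (ℕ.+-mono-≤ (bound zero) (∣Σℤ∣≤ (λ i → f (suc i)) (λ i → bound (suc i))))

  ∣±1*i∣≡∣i∣ : ∀ {h} i → (h ≡ + 1) ⊎ (h ≡ ℤ.- + 1) → ∣ h * i ∣ ≡ ∣ i ∣
  ∣±1*i∣≡∣i∣ i (inj₁ refl) = cong ∣_∣ (ℤ.*-identityˡ i)
  ∣±1*i∣≡∣i∣ i (inj₂ refl) = trans (cong ∣_∣ (ℤ.-1*i≡-i i)) (ℤ.∣-i∣≡∣i∣ i)

  ∣Σℤ±1*∣≤ : ∀ {n} (h e : Fin n → ℤ) {b} → (∀ i → (h i ≡ + 1) ⊎ (h i ≡ ℤ.- + 1)) →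
    (∀ i → ∣ e i ∣ ℕ.≤ b) → ∣ Σℤ (λ i → h i * e i) ∣ ℕ.≤ n ℕ.* b
  ∣Σℤ±1*∣≤ h e ±1 bound = ∣Σℤ∣≤ (λ i → h i * e i) (λ i →
    ℕ.≤-trans (ℕ.≤-reflexive (∣±1*i∣≡∣i∣ (e i) (±1 i))) (bound i))

  maxFin-upper : ∀ {n} (g : Fin n → ℕ) i → g i ℕ.≤ maxFin g
  maxFin-upper g zero    = ℕ.m≤m⊔n _ _
  maxFin-upper g (suc i) = ℕ.≤-trans (maxFin-upper (λ i → g (suc i)) i) (ℕ.m≤n⊔m _ _)

module IntegerBounds where
  open import Data.Integer using (_+_; _*_; -_; _≤_; _<_)

  i≤+∣i∣ : ∀ i → i ≤ + ∣ i ∣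
  i≤+∣i∣ (+ _)    = ℤ.≤-refl
  i≤+∣i∣ -[1+ _ ] = ℤ.-≤+

  i≤j≤k⇒∣j∣≤∣i∣⊔∣k∣ : ∀ {i j k} → i ≤ j → j ≤ k → ∣ j ∣ ℕ.≤ ∣ i ∣ ℕ.⊔ ∣ k ∣
  i≤j≤k⇒∣j∣≤∣i∣⊔∣k∣ {i} {+ _}      {k} _   j≤k =
    ℕ.m≤n⇒m≤o⊔n ∣ i ∣ (ℤ.drop‿+≤+ (ℤ.≤-trans j≤k (i≤+∣i∣ k)))
  i≤j≤k⇒∣j∣≤∣i∣⊔∣k∣ {i} { -[1+ n ]} {k} i≤j _ =
    ℕ.m≤n⇒m≤n⊔o ∣ k ∣ (subst (suc n ℕ.≤_) (ℤ.∣-i∣≡∣i∣ i)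
      (ℤ.drop‿+≤+ (ℤ.≤-trans (ℤ.neg-mono-≤ i≤j) (i≤+∣i∣ (- i)))))

  ∣j*u+c∣≤∣i*u+c∣⊔∣k*u+c∣ : ∀ u c {i j k} → i ≤ j → j ≤ k →
    ∣ j * u + c ∣ ℕ.≤ ∣ i * u + c ∣ ℕ.⊔ ∣ k * u + c ∣
  ∣j*u+c∣≤∣i*u+c∣⊔∣k*u+c∣ u@(+ _) c i≤j j≤k =
    i≤j≤k⇒∣j∣≤∣i∣⊔∣k∣ (ℤ.+-monoˡ-≤ c (ℤ.*-monoʳ-≤-nonNeg u i≤j))
                      (ℤ.+-monoˡ-≤ c (ℤ.*-monoʳ-≤-nonNeg u j≤k))
  ∣j*u+c∣≤∣i*u+c∣⊔∣k*u+c∣ u@(-[1+ _ ]) c {i} {j} {k} i≤j j≤k =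
    subst (∣ j * u + c ∣ ℕ.≤_) (ℕ.⊔-comm ∣ k * u + c ∣ ∣ i * u + c ∣)
      (i≤j≤k⇒∣j∣≤∣i∣⊔∣k∣ (ℤ.+-monoˡ-≤ c (ℤ.*-monoʳ-≤-nonPos u j≤k))
                        (ℤ.+-monoˡ-≤ c (ℤ.*-monoʳ-≤-nonPos u i≤j)))

  ∣affine∣≤⊔ : ∀ (g : ℤ → ℤ) u c → (∀ k → g k ≡ k * u + c) →
    ∀ {i j k} → i ≤ j → j ≤ k → ∣ g j ∣ ℕ.≤ ∣ g i ∣ ℕ.⊔ ∣ g k ∣
  ∣affine∣≤⊔ g u c g≡ {i} {j} {k} i≤j j≤k rewrite g≡ i | g≡ j | g≡ k =
    ∣j*u+c∣≤∣i*u+c∣⊔∣k*u+c∣ u c i≤j j≤k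

  ∣n*i∣⊔∣n*j∣≡n*[∣i∣⊔∣j∣] : ∀ n i j → ∣ + n * i ∣ ℕ.⊔ ∣ + n * j ∣ ≡ n ℕ.* (∣ i ∣ ℕ.⊔ ∣ j ∣)
  ∣n*i∣⊔∣n*j∣≡n*[∣i∣⊔∣j∣] n i j rewrite ℤ.abs-* (+ n) i | ℤ.abs-* (+ n) j =
    sym (ℕ.*-distribˡ-⊔ n ∣ i ∣ ∣ j ∣)

  i<suc[j]⇒i≤j : ∀ {i j} → i < ℤ.suc j → i ≤ j
  i<suc[j]⇒i≤j {i} {j} i<suc[j] = subst (i ≤_) (ℤ.pred-suc j) (ℤ.i<j⇒i≤pred[j] i<suc[j])

  [i+j]-j≡i : ∀ i j → i + j - j ≡ i
  [i+j]-j≡i = solve-∀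

  i≤j+k⇒i-k≤j : ∀ {i} j k → i ≤ j + k → i - k ≤ j
  i≤j+k⇒i-k≤j {i} j k i≤j+k = subst (i - k ≤_) ([i+j]-j≡i j k) (ℤ.+-monoˡ-≤ (- k) i≤j+k)

  i<j+k⇒i-k<j : ∀ {i} j k → i < j + k → i - k < j
  i<j+k⇒i-k<j {i} j k i<j+k = subst (i - k <_) ([i+j]-j≡i j k) (ℤ.+-monoˡ-< (- k) i<j+k)

  sgnℤ-*-∣∣ : ∀ i → sgnℤ i * + ∣ i ∣ ≡ i
  sgnℤ-*-∣∣ +0       = refl
  sgnℤ-*-∣∣ +[1+ n ] = ℤ.*-identityˡ +[1+ n ]
  sgnℤ-*-∣∣ -[1+ n ] = ℤ.-1*i≡-i +[1+ n ]

  ∣sgnℤ*j∣≤∣j∣ : ∀ i j → ∣ sgnℤ i * j ∣ ℕ.≤ ∣ j ∣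
  ∣sgnℤ*j∣≤∣j∣ +0       j = ℕ.z≤n
  ∣sgnℤ*j∣≤∣j∣ +[1+ _ ] j = ℕ.≤-reflexive (cong ∣_∣ (ℤ.*-identityˡ j))
  ∣sgnℤ*j∣≤∣j∣ -[1+ _ ] j = ℕ.≤-reflexive (trans (cong ∣_∣ (ℤ.-1*i≡-i j)) (ℤ.∣-i∣≡∣i∣ j))

module Hadamard {m : ℕ} {H : Fin (suc m) → Fin (suc m) → ℤ} (hadamard : IsHadamard (suc m) H) where
  open import Data.Integer using (_+_; _*_; -_)
  open import Algebra.Properties.Semiring.Sum ℤ.+-*-semiring
    using (sum; sum-cong-≗; ∑-comm; ∑-distrib-+; *-distribˡ-sum; *-distribʳ-sum)
  open FiniteSums

  n : ℕ
  n = suc m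

  mulH : (Fin n → ℤ) → Fin n → ℤ
  mulH x i = Σℤ (λ k → H i k * x k)

  mulHᵀ : (Fin n → ℤ) → Fin n → ℤ
  mulHᵀ z j = Σℤ (λ i → H i j * z i)

  mulHᵀ-mulH : ∀ x j → mulHᵀ (mulH x) j ≡ + n * x j
  mulHᵀ-mulH x j = begin
    Σℤ (λ i → H i j * mulH x i)
      ≡⟨ Σℤ≡sum (λ i → H i j * mulH x i) ⟩
    sum (λ i → H i j * Σℤ (λ k → H i k * x k))
      ≡⟨ sum-cong-≗ (λ i → trans (cong (H i j *_) (Σℤ≡sum (λ k → H i k * x k)))
                                  (*-distribˡ-sum (H i j) (λ k → H i k * x k))) ⟩
    sum (λ i → sum (λ k → H i j * (H i k * x k)))
      ≡⟨ ∑-comm (λ i k → H i j * (H i k * x k)) ⟩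
    sum (λ k → sum (λ i → H i j * (H i k * x k)))
      ≡⟨ sum-cong-≗ (λ k → trans (sum-cong-≗ (λ i → sym (ℤ.*-assoc (H i j) (H i k) (x k))))
                                  (sym (*-distribʳ-sum (x k) (λ i → H i j * H i k)))) ⟩
    sum (λ k → sum (λ i → H i j * H i k) * x k)
      ≡⟨ sum-cong-≗ (λ k → cong (_* x k)
           (trans (sym (Σℤ≡sum (λ i → H i j * H i k))) (proj₂ hadamard j k))) ⟩
    sum (λ k → (if does (j ≟ k) then + n else + 0) * x k)
      ≡⟨ sum-indicator j (+ n) x ⟩
    + n * x j ∎
    where open ≡-Reasoning

  mulHᵀ-residual : ∀ x z j → + n * (mulHᵀ z j - x j) ≡ mulHᵀ (λ i → + n * z i - mulH x i) j
  mulHᵀ-residual x z j = sym (begin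
    Σℤ (λ i → H i j * (+ n * z i - mulH x i))
      ≡⟨ Σℤ≡sum (λ i → H i j * (+ n * z i - mulH x i)) ⟩
    sum (λ i → H i j * (+ n * z i - mulH x i))
      ≡⟨ sum-cong-≗ (λ i → expand (+ n) (H i j) (z i) (mulH x i)) ⟩
    sum (λ i → + n * Hz i + - + 1 * HHx i)
      ≡⟨ ∑-distrib-+ (λ i → + n * Hz i) (λ i → - + 1 * HHx i) ⟩
    sum (λ i → + n * Hz i) + sum (λ i → - + 1 * HHx i)
      ≡⟨ cong₂ _+_ (*-distribˡ-sum (+ n) Hz) (*-distribˡ-sum (- + 1) HHx) ⟨
    + n * sum Hz + - + 1 * sum HHx
      ≡⟨ cong₂ (λ a b → + n * a + - + 1 * b) (Σℤ≡sum Hz) (Σℤ≡sum HHx) ⟨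
    + n * mulHᵀ z j + - + 1 * mulHᵀ (mulH x) j
      ≡⟨ cong (λ b → + n * mulHᵀ z j + - + 1 * b) (mulHᵀ-mulH x j) ⟩
    + n * mulHᵀ z j + - + 1 * (+ n * x j)
      ≡⟨ collect (+ n) (mulHᵀ z j) (x j) ⟩
    + n * (mulHᵀ z j - x j) ∎)
    where
    open ≡-Reasoning
    Hz HHx : Fin n → ℤ
    Hz i = H i j * z i
    HHx i = H i j * mulH x i
    expand : ∀ N h a b → h * (N * a - b) ≡ N * (h * a) + - + 1 * (h * b)
    expand = solve-∀
    collect : ∀ N a b → N * a + - + 1 * (N * b) ≡ N * (a - b)
    collect = solve-∀

  ∣mulH∣≤ : ∀ x i → ∣ mulH x i ∣ ℕ.≤ n ℕ.* supNorm x
  ∣mulH∣≤ x i = ∣Σℤ±1*∣≤ (H i) x (proj₁ hadamard i) (maxFin-upper (λ k → ∣ x k ∣))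

  ∣mulHᵀ-residual∣≤ : ∀ x z j (B : Fin n → ℕ) →
    (∀ i → ∣ + n * z i - mulH x i ∣ ℕ.≤ n ℕ.* B i) → ∣ mulHᵀ z j - x j ∣ ℕ.≤ n ℕ.* maxFin B
  ∣mulHᵀ-residual∣≤ x z j B bound = ℕ.*-cancelˡ-≤ n (begin
    n ℕ.* ∣ mulHᵀ z j - x j ∣                 ≡⟨ ℤ.abs-* (+ n) (mulHᵀ z j - x j) ⟨
    ∣ + n * (mulHᵀ z j - x j) ∣               ≡⟨ cong ∣_∣ (mulHᵀ-residual x z j) ⟩
    ∣ mulHᵀ (λ i → + n * z i - mulH x i) j ∣
      ≤⟨ ∣Σℤ±1*∣≤ (λ i → H i j) (λ i → + n * z i - mulH x i) (λ i → proj₁ hadamard i j)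
           (λ i → ℕ.≤-trans (bound i) (ℕ.*-monoʳ-≤ n (maxFin-upper B i))) ⟩
    n ℕ.* (n ℕ.* maxFin B)                    ∎)
    where open ℕ.≤-Reasoning

module FloorAndCeiling where
  open import Data.Integer using (_*_; -_; _≤_; _<_)
  open import Data.Integer.DivMod using (div-pos-is-/ℕ; [n/ℕd]*d≤n; n<s[n/ℕd]*d)
  open import Data.Rational as ℚ using (ℚ; mkℚ; floor; ceiling)
  import Data.Rational.Properties as ℚ
  open import Data.Rational.Unnormalised as ℚᵘ using (mkℚᵘ; _≃_; *≡*; *≤*)
  import Data.Rational.Unnormalised.Properties as ℚᵘ
  open import Relation.Nullary using (yes; no)

  _≃[_/1+_] : ℚ → ℤ → ℕ → Set
  q ≃[ a /1+ b ] = ℚ.toℚᵘ q ≃ mkℚᵘ a b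

  floor-bounds : ∀ q {a b} → q ≃[ a /1+ b ] →
    floor q * +[1+ b ] ≤ a × a < ℤ.suc (floor q) * +[1+ b ]
  floor-bounds (mkℚ p e _) {a} {b} (*≡* p*B≡a*E) =
    subst (λ g → g * B ≤ a × a < ℤ.suc g * B) (sym (div-pos-is-/ℕ p (suc e)))
      (ℤ.*-cancelʳ-≤-pos (f * B) a E (begin
        f * B * E   ≡⟨ swap f B E ⟩
        f * E * B   ≤⟨ ℤ.*-monoʳ-≤-nonNeg B ([n/ℕd]*d≤n p (suc e)) ⟩
        p * B       ≡⟨ p*B≡a*E ⟩
        a * E       ∎) ,
      ℤ.*-cancelʳ-<-nonNeg E (begin-strict
        a * E            ≡⟨ p*B≡a*E ⟨
        p * B            <⟨ ℤ.*-monoʳ-<-pos B (n<s[n/ℕd]*d p (suc e)) ⟩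
        ℤ.suc f * E * B  ≡⟨ swap (ℤ.suc f) E B ⟩
        ℤ.suc f * B * E  ∎))
    where
    open ℤ.≤-Reasoning
    E = +[1+ e ]
    B = +[1+ b ]
    f = p ℤ./ℕ suc e
    swap : ∀ x y z → x * y * z ≡ x * z * y
    swap = solve-∀

  ceiling-bound : ∀ q {a b} → q ≃[ a /1+ b ] → a ≤ ceiling q * +[1+ b ]
  ceiling-bound q@(mkℚ _ _ _) {a} {b} q≃a/b =
    subst₂ _≤_ (ℤ.neg-involutive a) (ℤ.neg-distribˡ-* (floor (ℚ.- q)) +[1+ b ])
      (ℤ.neg-mono-≤ (proj₁ (floor-bounds (ℚ.- q) -q≃-a/b)))
    where
    -q≃-a/b : (ℚ.- q) ≃[ - a /1+ b ]
    -q≃-a/b = ℚᵘ.≃-trans (ℚ.toℚᵘ-homo‿- q) (ℚᵘ.-‿cong q≃a/b)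

  sgnℤ-*-pos : ∀ i k → sgnℤ (i * +[1+ k ]) ≡ sgnℤ i
  sgnℤ-*-pos +0       k = refl
  sgnℤ-*-pos +[1+ _ ] k = refl
  sgnℤ-*-pos -[1+ _ ] k = refl

  sgnℚ-≃ : ∀ q {a b} → q ≃[ a /1+ b ] → sgnℚ q ≡ sgnℤ a
  sgnℚ-≃ (mkℚ p e _) {a} {b} (*≡* p*B≡a*E) =
    trans (sym (sgnℤ-*-pos p b)) (trans (cong sgnℤ p*B≡a*E) (sgnℤ-*-pos a e))

  0⊔-≃ : ∀ q {a b} → q ≃[ a /1+ b ] → (ℚ.0ℚ ℚ.⊔ q) ≃[ +0 ℤ.⊔ a /1+ b ]
  0⊔-≃ q {a} {b} q≃a/b with +0 ℤ.≤? a
  ... | yes 0≤a =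
    subst₂ (λ r c → r ≃[ c /1+ b ]) (sym (ℚ.p≤q⇒p⊔q≡q 0≤q)) (sym (ℤ.i≤j⇒i⊔j≡j 0≤a)) q≃a/b
    where
    0≤q : ℚ.0ℚ ℚ.≤ q
    0≤q = ℚ.toℚᵘ-cancel-≤ (ℚᵘ.≤-respʳ-≃ (ℚᵘ.≃-sym q≃a/b)
            (*≤* (subst (+0 ≤_) (sym (ℤ.*-identityʳ a)) 0≤a)))
  ... | no 0≰a =
    subst₂ (λ r c → r ≃[ c /1+ b ]) (sym (ℚ.p≥q⇒p⊔q≡p q≤0)) (sym (ℤ.i≥j⇒i⊔j≡i a≤0)) (*≡* refl)
    where
    a≤0 : a ≤ +0
    a≤0 = ℤ.<⇒≤ (ℤ.≰⇒> 0≰a)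
    q≤0 : q ℚ.≤ ℚ.0ℚ
    q≤0 = ℚ.toℚᵘ-cancel-≤ (ℚᵘ.≤-respˡ-≃ (ℚᵘ.≃-sym q≃a/b)
            (*≤* (subst (_≤ +0) (sym (ℤ.*-identityʳ a)) a≤0)))

module DeadZoneQuantiser where
  open import Data.Integer using (_+_; _*_; _≤_; _<_; _⊔_)
  open import Data.Rational as ℚ using (floor)
  import Data.Rational.Properties as ℚ
  open import Data.Rational.Unnormalised as ℚᵘ using (mkℚᵘ; *≡*)
  import Data.Rational.Unnormalised.Properties as ℚᵘ
  open import Data.Empty using (⊥-elim)
  open FloorAndCeiling

  data ClampedFloor (A D : ℤ) : ℕ → Set where
    below : A < D → ClampedFloor A D 0
    level : ∀ k → +[1+ k ] * D ≤ A → A < ℤ.suc +[1+ k ] * D → ClampedFloor A D (suc k)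

  clampedFloor : ∀ {A} f e → f * +[1+ e ] ≤ +0 ⊔ A → +0 ⊔ A < ℤ.suc f * +[1+ e ] →
    ∃[ k ] f ≡ + k × ClampedFloor A +[1+ e ] k
  clampedFloor {A} -[1+ j ] e _ upper = ⊥-elim (ℤ.<-irrefl refl (begin-strict
    +0 ⊔ A                     <⟨ upper ⟩
    ℤ.suc -[1+ j ] * +[1+ e ]
      ≤⟨ ℤ.*-monoʳ-≤-nonNeg +[1+ e ] (ℤ.i<j⇒suc[i]≤j { -[1+ j ]} {+0} ℤ.-<+) ⟩
    +0 * +[1+ e ]              ≤⟨ ℤ.i≤i⊔j +0 A ⟩
    +0 ⊔ A                     ∎))
    where open ℤ.≤-Reasoning
  clampedFloor {A} +0 e _ upper =
    0 , refl , below (ℤ.≤-<-trans (ℤ.i≤j⊔i +0 A) (subst (+0 ⊔ A <_) (ℤ.*-identityˡ +[1+ e ]) upper))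
  clampedFloor {A} +[1+ k ] e lower upper =
    suc k , refl ,
    level k (subst (+[1+ k ] * +[1+ e ] ≤_) 0⊔A≡A lower) (ℤ.≤-<-trans (ℤ.i≤j⊔i +0 A) upper)
    where
    0⊔A≡A : +0 ⊔ A ≡ A
    0⊔A≡A with ℤ.⊔-sel +0 A
    ... | inj₂ 0⊔A≡A = 0⊔A≡A
    ... | inj₁ 0⊔A≡0 =
      ⊥-elim (ℤ.<-irrefl refl (ℤ.<-≤-trans (ℤ.+<+ ℕ.z<s) (subst (_ ≤_) 0⊔A≡0 lower)))

  DQ-level : ∀ m d δ s →
    ∃[ k ] DQ δ (suc d) (s ℚ./ suc m) ≡ sgnℤ s * + k ×
           ClampedFloor (+ ∣ s ∣ + +[1+ m ] * δ) (+[1+ m ] * +[1+ d ]) k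
  DQ-level m d δ s =
    let k , floor-v≡k , clamped = clampedFloor (floor v) _ (proj₁ v-bounds) (proj₂ v-bounds)
    in  k , cong₂ _*_ (sgnℚ-≃ q q≃) floor-v≡k , clamped
    where
    over-N : ∀ a δ N → (a * + 1 + δ * N) * N ≡ (a + N * δ) * N
    over-N = solve-∀
    N = +[1+ m ]
    A = + ∣ s ∣ + N * δ
    q = s ℚ./ suc m
    w = ℚ.∣ q ∣ ℚ.+ (δ ℚ./ 1)
    v = (ℚ.0ℚ ℚ.⊔ w) ℚ.* (+ 1 ℚ./ suc d)
    q≃ : q ≃[ s /1+ m ]
    q≃ = ℚ.toℚᵘ-fromℚᵘ (mkℚᵘ s m)
    w≃ : w ≃[ A /1+ m ]
    w≃ = ℚᵘ.≃-trans (ℚ.toℚᵘ-homo-+ ℚ.∣ q ∣ (δ ℚ./ 1))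
           (ℚᵘ.≃-trans (ℚᵘ.+-cong (ℚᵘ.≃-trans (ℚ.toℚᵘ-homo-∣-∣ q) (ℚᵘ.∣-∣-cong q≃))
                                   (ℚ.toℚᵘ-fromℚᵘ (mkℚᵘ δ 0)))
                       (*≡* (trans (over-N (+ ∣ s ∣) δ N)
                                   (cong (λ n → A * + n) (sym (ℕ.*-identityʳ (suc m)))))))
    v≃ : v ≃[ +0 ⊔ A /1+ d ℕ.+ m ℕ.* suc d ]
    v≃ = ℚᵘ.≃-trans (ℚ.toℚᵘ-homo-* (ℚ.0ℚ ℚ.⊔ w) (+ 1 ℚ./ suc d))
           (ℚᵘ.≃-trans (ℚᵘ.*-cong (0⊔-≃ w w≃) (ℚ.toℚᵘ-fromℚᵘ (mkℚᵘ (+ 1) d)))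
                       (*≡* (cong (_* (N * +[1+ d ])) (ℤ.*-identityʳ (+0 ⊔ A)))))
    v-bounds = floor-bounds v v≃

-- Coordinate i of n z − H x, for n = suc m and Δᵢ = suc d.
module Coordinate (m d : ℕ) (δ γ : ℤ) (Γ : ℕ) where
  open import Data.Integer using (_+_; _*_; -_; _≤_; _<_)
  open import Data.Rational as ℚ using (floor; ceiling)
  import Data.Rational.Properties as ℚ
  open import Data.Rational.Unnormalised using (mkℚᵘ)
  open import Relation.Nullary using (Dec; yes; no)
  open import Relation.Nullary.Decidable using (dec-true)
  open FloorAndCeiling
  open DeadZoneQuantiser
  open IntegerBounds

  N Δ D : ℤ
  N = +[1+ m ]
  Δ = +[1+ d ]
  D = N * Δ

  residual : ℤ → ℤ
  residual s = N * IQ γ Γ (DQ δ (suc d) (s ℚ./ suc m)) - s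

  U L : ℤ → ℤ
  U k = k * (+ Γ - Δ) + γ + δ
  L k = U k - + Γ

  IQ-sgn : ∀ s j → IQ γ Γ (sgnℤ s * +[1+ j ]) ≡ sgnℤ s * (+ Γ * +[1+ j ] + γ)
  IQ-sgn +0       j = refl
  IQ-sgn +[1+ _ ] j = cong (IQ γ Γ) (ℤ.*-identityˡ +[1+ j ])
  IQ-sgn -[1+ _ ] j = cong (IQ γ Γ) (ℤ.-1*i≡-i +[1+ j ])

  ∣residual∣-level-zero : ∀ s → ∣ N * IQ γ Γ (sgnℤ s * + 0) - s ∣ ≡ ∣ s ∣
  ∣residual∣-level-zero s rewrite ℤ.*-zeroʳ (sgnℤ s) | ℤ.*-zeroʳ N | ℤ.+-identityˡ (- s) =
    ℤ.∣-i∣≡∣i∣ s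

  ∣residual∣-level-suc : ∀ s j →
    ∣ N * IQ γ Γ (sgnℤ s * +[1+ j ]) - s ∣ ℕ.≤ ∣ N * (+ Γ * +[1+ j ] + γ) - + ∣ s ∣ ∣
  ∣residual∣-level-suc s j = begin
    ∣ N * IQ γ Γ (sgnℤ s * +[1+ j ]) - s ∣
      ≡⟨ cong ∣_∣ (cong₂ (λ a b → N * a - b) (IQ-sgn s j) (sym (sgnℤ-*-∣∣ s))) ⟩
    ∣ N * (sgnℤ s * K) - sgnℤ s * + ∣ s ∣ ∣
      ≡⟨ cong ∣_∣ (factor N (sgnℤ s) K (+ ∣ s ∣)) ⟩
    ∣ sgnℤ s * (N * K - + ∣ s ∣) ∣
      ≤⟨ ∣sgnℤ*j∣≤∣j∣ s (N * K - + ∣ s ∣) ⟩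
    ∣ N * K - + ∣ s ∣ ∣ ∎
    where
    open ℕ.≤-Reasoning
    K = + Γ * +[1+ j ] + γ
    factor : ∀ N σ K a → N * (σ * K) - σ * a ≡ σ * (N * K - a)
    factor = solve-∀

  level-residual-≡ : ∀ k t → N * (+ Γ * k + γ) - t ≡ N * U k - (t + N * δ - k * D)
  level-residual-≡ k t = identity N (+ Γ) Δ γ δ k t
    where
    identity : ∀ N G Δ γ δ k t →
      N * (G * k + γ) - t ≡ N * (k * (G - Δ) + γ + δ) - (t + N * δ - k * (N * Δ))
    identity = solve-∀

  level-residual-window : ∀ k t → k * D ≤ t + N * δ → t + N * δ < ℤ.suc k * D →
    N * L (ℤ.suc k) < N * (+ Γ * k + γ) - t × N * (+ Γ * k + γ) - t ≤ N * U k
  level-residual-window k t lower upper =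
    (begin-strict
      N * L (ℤ.suc k)        ≡⟨ L-step N (+ Γ) Δ γ δ k ⟩
      N * U k - D            <⟨ ℤ.+-monoʳ-< (N * U k) (ℤ.neg-mono-< r<D) ⟩
      N * U k - r            ≡⟨ level-residual-≡ k t ⟨
      N * (+ Γ * k + γ) - t  ∎) ,
    (begin
      N * (+ Γ * k + γ) - t  ≡⟨ level-residual-≡ k t ⟩
      N * U k - r            ≤⟨ ℤ.+-monoʳ-≤ (N * U k) (ℤ.neg-mono-≤ (ℤ.i≤j⇒0≤j-i lower)) ⟩
      N * U k + +0           ≡⟨ ℤ.+-identityʳ (N * U k) ⟩
      N * U k                ∎)
    where
    open ℤ.≤-Reasoning
    r = t + N * δ - k * D
    L-step : ∀ N G Δ γ δ k →
      N * ((+ 1 + k) * (G - Δ) + γ + δ - G) ≡ N * (k * (G - Δ) + γ + δ) - N * Δ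
    L-step = solve-∀
    suc-step : ∀ k D → (+ 1 + k) * D - k * D ≡ D
    suc-step = solve-∀
    r<D : r < D
    r<D = subst (r <_) (suc-step k D) (ℤ.+-monoˡ-< (- (k * D)) upper)

  ∣s∣≤N∣Δ-δ∣ : ∀ s → + ∣ s ∣ + N * δ < D → ∣ s ∣ ℕ.≤ suc m ℕ.* ∣ Δ - δ ∣
  ∣s∣≤N∣Δ-δ∣ s A<D = ℤ.drop‿+≤+ (ℤ.<⇒≤ (begin-strict
    + ∣ s ∣                  ≡⟨ [i+j]-j≡i (+ ∣ s ∣) (N * δ) ⟨
    + ∣ s ∣ + N * δ - N * δ  <⟨ ℤ.+-monoˡ-< (- (N * δ)) A<D ⟩
    N * Δ - N * δ            ≡⟨ factor N Δ δ ⟩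
    N * (Δ - δ)              ≤⟨ ℤ.*-monoˡ-≤-nonNeg N (i≤+∣i∣ (Δ - δ)) ⟩
    N * + ∣ Δ - δ ∣          ≡⟨ ℤ.pos-* (suc m) ∣ Δ - δ ∣ ⟨
    + (suc m ℕ.* ∣ Δ - δ ∣)  ∎))
    where
    open ℤ.≤-Reasoning
    factor : ∀ N a b → N * a - N * b ≡ N * (a - b)
    factor = solve-∀

  ∣residual∣≤-by-level : ∀ {B} s →
    (+ ∣ s ∣ + N * δ < D → ∣ s ∣ ℕ.≤ suc m ℕ.* B) →
    (∀ j → +[1+ j ] * D ≤ + ∣ s ∣ + N * δ → + ∣ s ∣ + N * δ < ℤ.suc +[1+ j ] * D →
           ∣ N * (+ Γ * +[1+ j ] + γ) - + ∣ s ∣ ∣ ℕ.≤ suc m ℕ.* B) →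
    ∣ residual s ∣ ℕ.≤ suc m ℕ.* B
  ∣residual∣≤-by-level {B} s on-below on-level with DQ-level m d δ s
  ... | 0     , DQ≡ , below A<D =
    subst (ℕ._≤ suc m ℕ.* B)
      (sym (trans (cong (λ q → ∣ N * IQ γ Γ q - s ∣) DQ≡) (∣residual∣-level-zero s)))
      (on-below A<D)
  ... | suc j , DQ≡ , level .j lower upper =
    subst (ℕ._≤ suc m ℕ.* B) (cong (λ q → ∣ N * IQ γ Γ q - s ∣) (sym DQ≡))
      (ℕ.≤-trans (∣residual∣-level-suc s j) (on-level j lower upper))

  module EqualSteps (Γ≡Δ : Γ ≡ suc d) where
    U≡γ+δ : ∀ k → U k ≡ γ + δ
    U≡γ+δ k = trans (cong (λ G → k * (+ G - Δ) + γ + δ) Γ≡Δ) (vanish k Δ γ δ)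
      where
      vanish : ∀ k Δ γ δ → k * (Δ - Δ) + γ + δ ≡ γ + δ
      vanish = solve-∀

    L≡γ+δ-Δ : ∀ k → L k ≡ γ + δ - Δ
    L≡γ+δ-Δ k = cong₂ (λ u G → u - + G) (U≡γ+δ k) Γ≡Δ

    window≤maxT : ∣ γ + δ - Δ ∣ ℕ.⊔ ∣ γ + δ ∣ ℕ.≤ maxT δ γ (suc d)
    window≤maxT = ℕ.⊔-lub (ℕ.m≤n⇒m≤n⊔o ∣ Δ - δ ∣ (ℕ.m≤n⊔m ∣ γ + δ ∣ ∣ γ + δ - Δ ∣))
                          (ℕ.m≤n⇒m≤n⊔o ∣ Δ - δ ∣ (ℕ.m≤m⊔n ∣ γ + δ ∣ ∣ γ + δ - Δ ∣))

    ∣residual∣≤N*maxT : ∀ s → ∣ residual s ∣ ℕ.≤ suc m ℕ.* maxT δ γ (suc d)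
    ∣residual∣≤N*maxT s = ∣residual∣≤-by-level s
      (λ A<D → ℕ.≤-trans (∣s∣≤N∣Δ-δ∣ s A<D) (ℕ.*-monoʳ-≤ (suc m) (ℕ.m≤n⊔m _ _)))
      (λ j → on-level +[1+ j ])
      where
      open ℕ.≤-Reasoning
      on-level : ∀ k → k * D ≤ + ∣ s ∣ + N * δ → + ∣ s ∣ + N * δ < ℤ.suc k * D →
        ∣ N * (+ Γ * k + γ) - + ∣ s ∣ ∣ ℕ.≤ suc m ℕ.* maxT δ γ (suc d)
      on-level k lower upper = begin
        ∣ N * (+ Γ * k + γ) - + ∣ s ∣ ∣
          ≤⟨ i≤j≤k⇒∣j∣≤∣i∣⊔∣k∣ (ℤ.<⇒≤ (proj₁ window)) (proj₂ window) ⟩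
        ∣ N * L (ℤ.suc k) ∣ ℕ.⊔ ∣ N * U k ∣
          ≡⟨ ∣n*i∣⊔∣n*j∣≡n*[∣i∣⊔∣j∣] (suc m) (L (ℤ.suc k)) (U k) ⟩
        suc m ℕ.* (∣ L (ℤ.suc k) ∣ ℕ.⊔ ∣ U k ∣)
          ≡⟨ cong₂ (λ a b → suc m ℕ.* (∣ a ∣ ℕ.⊔ ∣ b ∣)) (L≡γ+δ-Δ (ℤ.suc k)) (U≡γ+δ k) ⟩
        suc m ℕ.* (∣ γ + δ - Δ ∣ ℕ.⊔ ∣ γ + δ ∣)
          ≤⟨ ℕ.*-monoʳ-≤ (suc m) window≤maxT ⟩
        suc m ℕ.* maxT δ γ (suc d) ∎
        where window = level-residual-window k (+ ∣ s ∣) lower upper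

  module GeneralSteps (X : ℕ) where
    F C : ℤ
    F = floor (ratio X δ (suc d))
    C = ceiling (ratio X δ (suc d))

    ratio≃ : ratio X δ (suc d) ≃[ + X + δ /1+ d ]
    ratio≃ = ℚ.toℚᵘ-fromℚᵘ (mkℚᵘ (+ X + δ) d)

    S-upper S-lower : ℕ
    S-upper = if does ((Δ - δ) ℤ.≤? + X) then ∣ (+ Γ - Δ) + γ + δ ∣ ℕ.⊔ ∣ U F ∣ else 0
    S-lower = if does ((Δ - δ) ℤ.<? + X) then ∣ L (+ 2) ∣ ℕ.⊔ ∣ L C ∣ else 0

    ∣Δ-δ∣≤maxS : ∣ Δ - δ ∣ ℕ.≤ maxS δ γ (suc d) Γ X
    ∣Δ-δ∣≤maxS = ℕ.m≤n⇒m≤n⊔o S-lower (ℕ.m≤m⊔n ∣ Δ - δ ∣ S-upper)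

    upper-ends≤maxS : Δ - δ ≤ + X → ∣ U (+ 1) ∣ ℕ.⊔ ∣ U F ∣ ℕ.≤ maxS δ γ (suc d) Γ X
    upper-ends≤maxS h = ℕ.m≤n⇒m≤n⊔o S-lower (ℕ.m≤n⇒m≤o⊔n ∣ Δ - δ ∣ upper-ends≤S-upper)
      where
      upper-ends≤S-upper : ∣ U (+ 1) ∣ ℕ.⊔ ∣ U F ∣ ℕ.≤ S-upper
      upper-ends≤S-upper rewrite dec-true ((Δ - δ) ℤ.≤? + X) h | ℤ.*-identityˡ (+ Γ - Δ) =
        ℕ.≤-refl

    lower-ends≤maxS : Δ - δ < + X → ∣ L (+ 2) ∣ ℕ.⊔ ∣ L C ∣ ℕ.≤ maxS δ γ (suc d) Γ X
    lower-ends≤maxS h = ℕ.m≤n⇒m≤o⊔n (∣ Δ - δ ∣ ℕ.⊔ S-upper) lower-ends≤S-lower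
      where
      lower-ends≤S-lower : ∣ L (+ 2) ∣ ℕ.⊔ ∣ L C ∣ ℕ.≤ S-lower
      lower-ends≤S-lower rewrite dec-true ((Δ - δ) ℤ.<? + X) h = ℕ.≤-refl

    Δ≤k*Δ : ∀ {k} → + 1 ≤ k → Δ ≤ k * Δ
    Δ≤k*Δ {k} 1≤k = subst (_≤ k * Δ) (ℤ.*-identityˡ Δ) (ℤ.*-monoʳ-≤-nonNeg Δ 1≤k)

    U≤maxS : ∀ k → + 1 ≤ k → k * Δ ≤ + X + δ → ∣ U k ∣ ℕ.≤ maxS δ γ (suc d) Γ X
    U≤maxS k 1≤k k*Δ≤X+δ =
      ℕ.≤-trans (∣affine∣≤⊔ U (+ Γ - Δ) (γ + δ) (λ k → ℤ.+-assoc (k * (+ Γ - Δ)) γ δ) 1≤k k≤F)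
                (upper-ends≤maxS (i≤j+k⇒i-k≤j (+ X) δ (ℤ.≤-trans (Δ≤k*Δ 1≤k) k*Δ≤X+δ)))
      where
      k≤F : k ≤ F
      k≤F = i<suc[j]⇒i≤j (ℤ.*-cancelʳ-<-nonNeg Δ
              (ℤ.≤-<-trans k*Δ≤X+δ (proj₂ (floor-bounds _ ratio≃))))

    L≤maxS : ∀ k → + 1 ≤ k → k * Δ < + X + δ → ∣ L (ℤ.suc k) ∣ ℕ.≤ maxS δ γ (suc d) Γ X
    L≤maxS k 1≤k k*Δ<X+δ =
      ℕ.≤-trans (∣affine∣≤⊔ L (+ Γ - Δ) (γ + δ - + Γ) (λ k → regroup k (+ Γ - Δ) γ δ (+ Γ))
                             (ℤ.+-monoʳ-≤ (+ 1) 1≤k) suc[k]≤C)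
                (lower-ends≤maxS (i<j+k⇒i-k<j (+ X) δ (ℤ.≤-<-trans (Δ≤k*Δ 1≤k) k*Δ<X+δ)))
      where
      regroup : ∀ k u γ δ G → k * u + γ + δ - G ≡ k * u + (γ + δ - G)
      regroup = solve-∀
      suc[k]≤C : ℤ.suc k ≤ C
      suc[k]≤C = ℤ.i<j⇒suc[i]≤j (ℤ.*-cancelʳ-<-nonNeg {k} {C} Δ
                   (ℤ.<-≤-trans k*Δ<X+δ (ceiling-bound _ ratio≃)))

    module _ {s} (∣s∣≤NX : ∣ s ∣ ℕ.≤ suc m ℕ.* X) where
      A : ℤ
      A = + ∣ s ∣ + N * δ

      A≤N[X+δ] : A ≤ N * (+ X + δ)
      A≤N[X+δ] = subst (A ≤_) (sym (ℤ.*-distribˡ-+ N (+ X) δ))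
        (ℤ.+-monoˡ-≤ (N * δ) (subst (+ ∣ s ∣ ≤_) (ℤ.pos-* (suc m) X) (ℤ.+≤+ ∣s∣≤NX)))

      N*[k*Δ]≡k*D : ∀ k → N * (k * Δ) ≡ k * D
      N*[k*Δ]≡k*D k = reorder N k Δ
        where
        reorder : ∀ N k Δ → N * (k * Δ) ≡ k * (N * Δ)
        reorder = solve-∀

      k*D≤A⇒k*Δ≤X+δ : ∀ k → k * D ≤ A → k * Δ ≤ + X + δ
      k*D≤A⇒k*Δ≤X+δ k k*D≤A = ℤ.*-cancelˡ-≤-pos (k * Δ) (+ X + δ) N
        (subst (_≤ N * (+ X + δ)) (sym (N*[k*Δ]≡k*D k)) (ℤ.≤-trans k*D≤A A≤N[X+δ]))

      k*D<A⇒k*Δ<X+δ : ∀ k → k * D < A → k * Δ < + X + δ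
      k*D<A⇒k*Δ<X+δ k k*D<A = ℤ.*-cancelˡ-<-nonNeg N
        (subst (_< N * (+ X + δ)) (sym (N*[k*Δ]≡k*D k)) (ℤ.<-≤-trans k*D<A A≤N[X+δ]))

      ∣residual∣≤N*maxS : ∣ residual s ∣ ℕ.≤ suc m ℕ.* maxS δ γ (suc d) Γ X
      ∣residual∣≤N*maxS = ∣residual∣≤-by-level s
        (λ A<D → ℕ.≤-trans (∣s∣≤N∣Δ-δ∣ s A<D) (ℕ.*-monoʳ-≤ (suc m) ∣Δ-δ∣≤maxS))
        (λ j lower upper → on-level +[1+ j ] (ℤ.+≤+ (ℕ.s≤s ℕ.z≤n)) lower upper (A ℤ.≟ +[1+ j ] * D))
        where
        open ℕ.≤-Reasoning
        on-level : ∀ k → + 1 ≤ k → k * D ≤ A → A < ℤ.suc k * D → Dec (A ≡ k * D) →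
          ∣ N * (+ Γ * k + γ) - + ∣ s ∣ ∣ ℕ.≤ suc m ℕ.* maxS δ γ (suc d) Γ X
        on-level k 1≤k lower upper (yes A≡k*D) = begin
          ∣ N * (+ Γ * k + γ) - + ∣ s ∣ ∣  ≡⟨ cong ∣_∣ (level-residual-≡ k (+ ∣ s ∣)) ⟩
          ∣ N * U k - (A - k * D) ∣       ≡⟨ cong (λ r → ∣ N * U k - r ∣) (ℤ.i≡j⇒i-j≡0 A≡k*D) ⟩
          ∣ N * U k + +0 ∣                ≡⟨ cong ∣_∣ (ℤ.+-identityʳ (N * U k)) ⟩
          ∣ N * U k ∣                     ≡⟨ ℤ.abs-* N (U k) ⟩
          suc m ℕ.* ∣ U k ∣
            ≤⟨ ℕ.*-monoʳ-≤ (suc m) (U≤maxS k 1≤k (k*D≤A⇒k*Δ≤X+δ k lower)) ⟩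
          suc m ℕ.* maxS δ γ (suc d) Γ X  ∎
        on-level k 1≤k lower upper (no A≢k*D) = begin
          ∣ N * (+ Γ * k + γ) - + ∣ s ∣ ∣
            ≤⟨ i≤j≤k⇒∣j∣≤∣i∣⊔∣k∣ (ℤ.<⇒≤ (proj₁ window)) (proj₂ window) ⟩
          ∣ N * L (ℤ.suc k) ∣ ℕ.⊔ ∣ N * U k ∣
            ≡⟨ ∣n*i∣⊔∣n*j∣≡n*[∣i∣⊔∣j∣] (suc m) (L (ℤ.suc k)) (U k) ⟩
          suc m ℕ.* (∣ L (ℤ.suc k) ∣ ℕ.⊔ ∣ U k ∣)
            ≤⟨ ℕ.*-monoʳ-≤ (suc m) (ℕ.⊔-lub (L≤maxS k 1≤k k*Δ<X+δ) (U≤maxS k 1≤k (ℤ.<⇒≤ k*Δ<X+δ))) ⟩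
          suc m ℕ.* maxS δ γ (suc d) Γ X  ∎
          where
          window = level-residual-window k (+ ∣ s ∣) lower upper
          k*Δ<X+δ = k*D<A⇒k*Δ<X+δ k (ℤ.≤∧≢⇒< lower (λ k*D≡A → A≢k*D (sym k*D≡A)))

coordinate-bound : ∀ m {Δ} → 0 ℕ.< Δ → ∀ Γ δ γ X s → ∣ s ∣ ℕ.≤ suc m ℕ.* X →
  ∣ +[1+ m ] ℤ.* IQ γ Γ (DQ δ Δ (s ℚ./ suc m)) - s ∣ ℕ.≤ suc m ℕ.* maxS δ γ Δ Γ X
coordinate-bound m {suc d} _ Γ δ γ X s = Coordinate.GeneralSteps.∣residual∣≤N*maxS m d δ γ Γ X {s}

coordinate-bound-equal-steps : ∀ m {Δ Γ} → 0 ℕ.< Δ → Δ ≡ Γ → ∀ δ γ s →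
  ∣ +[1+ m ] ℤ.* IQ γ Γ (DQ δ Δ (s ℚ./ suc m)) - s ∣ ℕ.≤ suc m ℕ.* maxT δ γ Δ
coordinate-bound-equal-steps m {suc d} _ refl δ γ =
  Coordinate.EqualSteps.∣residual∣≤N*maxT m d δ γ (suc d) refl

open import Data.Nat using (_≤_; _<_; _*_)

theorem1 : (n : ℕ) → 1 ≤ n →
    (H : Fin n → Fin n → ℤ) → IsHadamard n H →
    (δ γ : Fin n → ℤ) → (Δ Γ : Fin n → ℕ) →
    (∀ i → 0 < Δ i) → (∀ i → 0 < Γ i) →
    ((x : Fin n → ℤ) → (j : Fin n) →
       ∣ reconstruct n H δ γ Δ Γ x j - x j ∣
         ≤ n * maxFin (λ i → maxS (δ i) (γ i) (Δ i) (Γ i) (supNorm x)))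
    ×
    ((∀ i → Δ i ≡ Γ i) → (x : Fin n → ℤ) → (j : Fin n) →
       ∣ reconstruct n H δ γ Δ Γ x j - x j ∣
         ≤ n * maxFin (λ i → maxT (δ i) (γ i) (Δ i)))
-- The bounds hold for every Γ.
theorem1 (suc m) _ H hadamard δ γ Δ Γ Δ>0 _ =
  (λ x j → ∣mulHᵀ-residual∣≤ x (quantised x) j _ (λ i →
     coordinate-bound m (Δ>0 i) (Γ i) (δ i) (γ i) (supNorm x) (mulH x i) (∣mulH∣≤ x i))) ,
  (λ Δ≡Γ x j → ∣mulHᵀ-residual∣≤ x (quantised x) j _ (λ i →
     coordinate-bound-equal-steps m (Δ>0 i) (Δ≡Γ i) (δ i) (γ i) (mulH x i)))
  where
  open Hadamard hadamard
  quantised : (Fin (suc m) → ℤ) → Fin (suc m) → ℤ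
  quantised x i = IQ (γ i) (Γ i) (DQ (δ i) (Δ i) (scaledH (suc m) H x i))
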